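{- (i) If $H_1$ and $H_2$ are $\operatorname{IR}$-graphs, then their Cartesian product $H_1\,\square\, H_2$ is an $\operatorname{IR}$-graph. (ii) For every $n\geq1$, the hypercube $Q_n$ is an $\operatorname{IR}$-graph; in particular the $4$-cycle $C_4\cong Q_2$ is an $\operatorname{IR}$-graph.
   Context: All graphs are finite and simple. For a graph $G=(V,E)$, $D\subseteq V$ and $v\in D$, let $\operatorname{PN}(v,D)=N[v]-N[D-\{v\}]$ (closed neighbourhoods). $D$ is irredundant if $\operatorname{PN}(v,D)\neq\varnothing$ for all $v\in D$; $\operatorname{IR}(G)$ is the maximum size of an irredundant set, and an $\operatorname{IR}(G)$-set is an irredundant set of size $\operatorname{IR}(G)$. The $\operatorname{IR}$-graph $G(\operatorname{IR})$ has the $\operatorname{IR}(G)$-sets as vertices, with $D\sim D'$ iff there are $u\in D$, $v\in D'$, $uv\in E(G)$, $D'=(D-\{u\})\cup\{v\}$. A graph $H$ is an $\operatorname{IR}$-graph if $H\cong G(\operatorname{IR})$ for some graph $G$. -}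

module Defs where

open import Data.Nat using (ℕ; zero; suc; _*_; _^_; _≤_; _%_)
open import Data.Fin using (Fin; zero; suc; toℕ; remQuot)
open import Data.Fin.Subset using (Subset; _∈_; _∉_; _-_; _∪_; ⁅_⁆; ∣_∣)
open import Data.Product using (Σ; ∃; ∃-syntax; _×_; _,_; proj₁; proj₂)
open import Data.Sum using (_⊎_; inj₁; inj₂)
open import Data.Empty using (⊥)
open import Relation.Nullary using (¬_; Dec; yes; no)
open import Relation.Nullary.Decidable using (_⊎-dec_; _×-dec_)
open import Relation.Binary.PropositionalEquality using (_≡_; _≢_; refl; sym)
import Data.Fin as Fin
import Data.Nat as Nat

record Graph (n : ℕ) : Set₁ where
  field
    Adj    : Fin n → Fin n → Set
    adj-sym    : ∀ {u v} → Adj u v → Adj v u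
    adj-irrefl : ∀ {u} → ¬ Adj u u
    adj?   : ∀ u v → Dec (Adj u v)
open Graph public

module _ {n : ℕ} (G : Graph n) where

  InN[_] : Fin n → Fin n → Set
  InN[ u ] w = (w ≡ u) ⊎ Adj G u w

  -- w ∈ PN(v, D) = N[v] - N[D - {v}]
  InPN : Fin n → Subset n → Fin n → Set
  InPN v D w = InN[ v ] w × (∀ u → u ∈ D → u ≢ v → ¬ InN[ u ] w)

  Irredundant : Subset n → Set
  Irredundant D = ∀ v → v ∈ D → ∃[ w ] InPN v D w

  IsIRSet : Subset n → Set
  IsIRSet D = Irredundant D × (∀ D′ → Irredundant D′ → ∣ D′ ∣ ≤ ∣ D ∣)

  IRAdj : Subset n → Subset n → Set
  IRAdj D D′ = ∃[ u ] ∃[ v ] (u ∈ D × v ∈ D′ × Adj G u v × D′ ≡ (D - u) ∪ ⁅ v ⁆)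

record IRIso {m n : ℕ} (H : Graph m) (G : Graph n) : Set where
  field
    f      : Fin m → Subset n
    f-IR   : ∀ i → IsIRSet G (f i)
    f-inj  : ∀ i j → f i ≡ f j → i ≡ j
    f-surj : ∀ D → IsIRSet G D → ∃[ i ] f i ≡ D
    f-adj  : ∀ i j → Adj H i j → IRAdj G (f i) (f j)
    f-adj⁻ : ∀ i j → IRAdj G (f i) (f j) → Adj H i j

IsIRGraph : {m : ℕ} → Graph m → Set₁
IsIRGraph H = ∃[ n ] Σ (Graph n) (λ G → IRIso H G)

_□_ : {m₁ m₂ : ℕ} → Graph m₁ → Graph m₂ → Graph (m₁ * m₂)
_□_ {m₁} {m₂} H₁ H₂ = record
  { Adj = A ; adj-sym = λ {u} {v} → s {u} {v} ; adj-irrefl = λ {u} → ir {u} ; adj? = d }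
  where
  P : Fin (m₁ * m₂) → Fin m₁ × Fin m₂
  P = remQuot m₂
  A : Fin (m₁ * m₂) → Fin (m₁ * m₂) → Set
  A k l = (proj₁ (P k) ≡ proj₁ (P l) × Adj H₂ (proj₂ (P k)) (proj₂ (P l)))
        ⊎ (Adj H₁ (proj₁ (P k)) (proj₁ (P l)) × proj₂ (P k) ≡ proj₂ (P l))
  s : ∀ {k l} → A k l → A l k
  s (inj₁ (e , a)) = inj₁ (sym e , adj-sym H₂ a)
  s (inj₂ (a , e)) = inj₂ (adj-sym H₁ a , sym e)
  ir : ∀ {k} → ¬ A k k
  ir (inj₁ (_ , a)) = adj-irrefl H₂ a
  ir (inj₂ (a , _)) = adj-irrefl H₁ a
  d : ∀ k l → Dec (A k l)
  d k l = ((proj₁ (P k) Fin.≟ proj₁ (P l)) ×-dec adj? H₂ (proj₂ (P k)) (proj₂ (P l)))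
          ⊎-dec (adj? H₁ (proj₁ (P k)) (proj₁ (P l)) ×-dec (proj₂ (P k) Fin.≟ proj₂ (P l)))

K₁ : Graph 1
K₁ = record { Adj = λ _ _ → ⊥ ; adj-sym = λ () ; adj-irrefl = λ () ; adj? = λ _ _ → no λ () }

K₂ : Graph 2
K₂ = record { Adj = λ u v → u ≢ v ; adj-sym = λ ne e → ne (sym e) ; adj-irrefl = λ ne → ne refl
            ; adj? = λ u v → d u v }
  where
  d : ∀ (u v : Fin 2) → Dec (u ≢ v)
  d u v with u Fin.≟ v
  ... | yes e = no λ ne → ne e
  ... | no ne = yes ne

Q : (n : ℕ) → Graph (2 ^ n)
Q zero    = K₁
Q (suc n) = K₂ □ Q n

C₄ : Graph 4
C₄ = record { Adj = A ; adj-sym = λ { (inj₁ e) → inj₂ e ; (inj₂ e) → inj₁ e }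
            ; adj-irrefl = λ {u} → ir u ; adj? = λ u v → (toℕ v Nat.≟ suc (toℕ u) % 4) ⊎-dec (toℕ u Nat.≟ suc (toℕ v) % 4) }
  where
  A : Fin 4 → Fin 4 → Set
  A u v = (toℕ v ≡ suc (toℕ u) % 4) ⊎ (toℕ u ≡ suc (toℕ v) % 4)
  ir : ∀ u → ¬ A u u
  ir zero (inj₁ ())
  ir zero (inj₂ ())
  ir (suc zero) (inj₁ ())
  ir (suc zero) (inj₂ ())
  ir (suc (suc zero)) (inj₁ ())
  ir (suc (suc zero)) (inj₂ ())
  ir (suc (suc (suc zero))) (inj₁ ())
  ir (suc (suc (suc zero))) (inj₂ ())

module Submission where

-- For graphs G₁, G₂ let G₁ ⊕ G₂ be their disjoint union.  Each
-- copy Gᵢ sits inside G₁ ⊕ G₂ as a union of components, so closed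
-- neighbourhoods, and hence private neighbours, never cross between the two
-- copies.  Consequently a set xs ++ ys is irredundant in G₁ ⊕ G₂ iff xs and ys
-- are irredundant in G₁ and G₂; since sizes add, the IR-sets of G₁ ⊕ G₂ are
-- exactly the concatenations of IR-sets of G₁ and of G₂, and an exchange along
-- an edge of G₁ ⊕ G₂ changes exactly one of the two halves.  Thus
-- (G₁ ⊕ G₂)(IR) ≅ G₁(IR) □ G₂(IR), which proves (i).
--
-- For (ii) we show that every complete graph
-- on at least one vertex is its own IR-graph (its IR-sets are the
-- singletons), so K₁ and K₂ are IR-graphs and Q n = K₂ □ … □ K₂ □ K₁ follows
-- by induction.  Finally C₄ ≅ Q 2 (checked by exhaustion) and being an
-- IR-graph is invariant under graph isomorphism.

open import Defs
import Data.Nat as ℕ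
open import Data.Nat using (ℕ; suc; _+_; _*_; _≤_; z≤n)
open import Data.Nat.Properties using (module ≤-Reasoning; +-mono-≤; +-cancelˡ-≤; +-cancelʳ-≤)
open import Data.Bool using (_∨_)
open import Data.Product using (Σ; ∃-syntax; _×_; _,_; proj₁; proj₂; uncurry)
open import Data.Sum using (_⊎_; inj₁; inj₂)
open import Data.Empty using (⊥; ⊥-elim)
open import Data.Fin using (Fin; zero; suc; _↑ˡ_; _↑ʳ_; splitAt; remQuot; combine; _≟_)
open import Data.Fin.Properties using (all?; splitAt-↑ˡ; splitAt-↑ʳ; splitAt⁻¹-↑ˡ; splitAt⁻¹-↑ʳ; ↑ˡ-injective; ↑ʳ-injective; remQuot-combine; combine-remQuot)
open import Data.Fin.Subset using (Subset; Empty; _∈_; _⊆_; _─_; _-_; _∪_; ⁅_⁆; ∣_∣; inside; outside) renaming (⊥ to ∅)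
open import Data.Fin.Subset.Properties using (∣⊥∣≡0; x∈⁅x⁆; x∈⁅y⁆⇒x≡y; ∣⁅x⁆∣≡1; p⊆q⇒∣p∣≤∣q∣; ⊆-antisym; nonempty?; Empty-unique; ∪-identityˡ; ∪-identityʳ; p─⊥≡p)
open import Data.Vec using ([]; _∷_; _++_; lookup; zipWith)
import Data.Vec as Vec
open import Data.Vec.Properties using (lookup-++ˡ; lookup-++ʳ; zipWith-++; ++-injective; []=⇒lookup; lookup⇒[]=)
open import Function using (_∘_; id)
open import Relation.Nullary using (¬_; Dec; yes; no)
open import Relation.Nullary.Decidable using (True; toWitness; _→-dec_)
open import Relation.Binary.PropositionalEquality using (_≡_; _≢_; refl; sym; trans; cong; cong₂; subst; subst₂; module ≡-Reasoning)

N-sym : ∀ {n} (G : Graph n) {u w} → InN[_] G u w → InN[_] G w u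
N-sym G (inj₁ refl) = inj₁ refl
N-sym G (inj₂ a)    = inj₂ (adj-sym G a)

∈-transfer : ∀ {m n} {p : Subset m} {q : Subset n} {i j} → lookup q j ≡ lookup p i → i ∈ p → j ∈ q
∈-transfer {q = q} {j = j} agree i∈p = lookup⇒[]= j q (trans agree ([]=⇒lookup i∈p))

record ComponentEmbedding {m n : ℕ} (H : Graph m) (G : Graph n) : Set where
  field
    ι            : Fin m → Fin n
    ι-injective  : ∀ {i j} → ι i ≡ ι j → i ≡ j
    adj-preserve : ∀ {i j} → Adj H i j → Adj G (ι i) (ι j)
    adj-reflect  : ∀ {i j} → Adj G (ι i) (ι j) → Adj H i j
    closed       : ∀ {i w} → Adj G (ι i) w → ∃[ j ] ι j ≡ w

  N-preserve : ∀ {i j} → InN[_] H i j → InN[_] G (ι i) (ι j)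
  N-preserve (inj₁ refl) = inj₁ refl
  N-preserve (inj₂ a)    = inj₂ (adj-preserve a)

  N-reflect : ∀ {i j} → InN[_] G (ι i) (ι j) → InN[_] H i j
  N-reflect (inj₁ e) = inj₁ (ι-injective e)
  N-reflect (inj₂ a) = inj₂ (adj-reflect a)

  N-closed : ∀ {i w} → InN[_] G (ι i) w → ∃[ j ] ι j ≡ w
  N-closed {i} (inj₁ refl) = i , refl
  N-closed     (inj₂ a)    = closed a

  module Restriction (xs : Subset m) (D : Subset n)
                     (restricts : ∀ i → lookup D (ι i) ≡ lookup xs i) where

    ∈-preserve : ∀ {i} → i ∈ xs → ι i ∈ D
    ∈-preserve {i} = ∈-transfer (restricts i)

    ∈-reflect : ∀ {i} → ι i ∈ D → i ∈ xs
    ∈-reflect {i} = ∈-transfer (sym (restricts i))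

    PN-preserve : ∀ {v w} → InPN H v xs w → InPN G (ι v) D (ι w)
    PN-preserve {v} {w} (w∈N[v] , w-private) = N-preserve w∈N[v] , undominated
      where
      -- a dominator of ι w lies in the image, hence would dominate w in H
      undominated : ∀ u → u ∈ D → u ≢ ι v → ¬ InN[_] G u (ι w)
      undominated u u∈D u≢ιv ιw∈N[u] with N-closed (N-sym G ιw∈N[u])
      ... | j , refl = w-private j (∈-reflect u∈D) (λ { refl → u≢ιv refl }) (N-reflect ιw∈N[u])

    PN-reflect : ∀ {v w} → InPN G (ι v) D w → ∃[ w₁ ] InPN H v xs w₁
    PN-reflect (w∈N[ιv] , w-private) with N-closed w∈N[ιv]
    ... | w₁ , refl = w₁ , N-reflect w∈N[ιv] ,
          λ u u∈xs u≢v → w-private (ι u) (∈-preserve u∈xs) (λ e → u≢v (ι-injective e)) ∘ N-preserve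

∣++∣ : ∀ {m n} (xs : Subset m) (ys : Subset n) → ∣ xs ++ ys ∣ ≡ ∣ xs ∣ + ∣ ys ∣
∣++∣ []             ys = refl
∣++∣ (inside ∷ xs)  ys = cong suc (∣++∣ xs ys)
∣++∣ (outside ∷ xs) ys = ∣++∣ xs ys

∣++∣-≤ : ∀ {m n} (xs xs′ : Subset m) (ys ys′ : Subset n) →
         ∣ xs ++ ys ∣ ≤ ∣ xs′ ++ ys′ ∣ → ∣ xs ∣ + ∣ ys ∣ ≤ ∣ xs′ ∣ + ∣ ys′ ∣
∣++∣-≤ xs xs′ ys ys′ = subst₂ _≤_ (∣++∣ xs ys) (∣++∣ xs′ ys′)

exchange : ∀ {n} → Subset n → Fin n → Fin n → Subset n
exchange D u v = (D - u) ∪ ⁅ v ⁆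

∅-++ : ∀ m n → ∅ {m + n} ≡ ∅ {m} ++ ∅ {n}
∅-++ ℕ.zero  n = refl
∅-++ (suc m) n = cong (outside ∷_) (∅-++ m n)

⁅↑ˡ⁆ : ∀ {m} n (i : Fin m) → ⁅ i ↑ˡ n ⁆ ≡ ⁅ i ⁆ ++ ∅ {n}
⁅↑ˡ⁆ {suc m} n zero    = cong (inside ∷_) (∅-++ m n)
⁅↑ˡ⁆         n (suc i) = cong (outside ∷_) (⁅↑ˡ⁆ n i)

⁅↑ʳ⁆ : ∀ m {n} (j : Fin n) → ⁅ m ↑ʳ j ⁆ ≡ ∅ {m} ++ ⁅ j ⁆
⁅↑ʳ⁆ ℕ.zero  j = refl
⁅↑ʳ⁆ (suc m) j = cong (outside ∷_) (⁅↑ʳ⁆ m j)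

─-++ : ∀ {m n} (xs as : Subset m) (ys bs : Subset n) → (xs ++ ys) ─ (as ++ bs) ≡ (xs ─ as) ++ (ys ─ bs)
─-++ xs as ys bs = zipWith-++ _ xs ys as bs

∪-++ : ∀ {m n} (xs as : Subset m) (ys bs : Subset n) → (xs ++ ys) ∪ (as ++ bs) ≡ (xs ∪ as) ++ (ys ∪ bs)
∪-++ xs as ys bs = zipWith-++ _∨_ xs ys as bs

exchange-++ˡ : ∀ {m n} (xs : Subset m) (ys : Subset n) u v →
               exchange (xs ++ ys) (u ↑ˡ n) (v ↑ˡ n) ≡ exchange xs u v ++ ys
exchange-++ˡ {n = n} xs ys u v = begin
  ((xs ++ ys) ─ ⁅ u ↑ˡ n ⁆) ∪ ⁅ v ↑ˡ n ⁆         ≡⟨ cong₂ (λ p q → ((xs ++ ys) ─ p) ∪ q) (⁅↑ˡ⁆ n u) (⁅↑ˡ⁆ n v) ⟩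
  ((xs ++ ys) ─ (⁅ u ⁆ ++ ∅)) ∪ (⁅ v ⁆ ++ ∅)     ≡⟨ cong (_∪ (⁅ v ⁆ ++ ∅)) (─-++ xs ⁅ u ⁆ ys ∅) ⟩
  ((xs - u) ++ (ys ─ ∅)) ∪ (⁅ v ⁆ ++ ∅)          ≡⟨ ∪-++ (xs - u) ⁅ v ⁆ (ys ─ ∅) ∅ ⟩
  exchange xs u v ++ ((ys ─ ∅) ∪ ∅)              ≡⟨ cong (exchange xs u v ++_) (trans (∪-identityʳ _) (p─⊥≡p ys)) ⟩
  exchange xs u v ++ ys                          ∎
  where open ≡-Reasoning

exchange-++ʳ : ∀ {m n} (xs : Subset m) (ys : Subset n) u v →
               exchange (xs ++ ys) (m ↑ʳ u) (m ↑ʳ v) ≡ xs ++ exchange ys u v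
exchange-++ʳ {m = m} xs ys u v = begin
  ((xs ++ ys) ─ ⁅ m ↑ʳ u ⁆) ∪ ⁅ m ↑ʳ v ⁆         ≡⟨ cong₂ (λ p q → ((xs ++ ys) ─ p) ∪ q) (⁅↑ʳ⁆ m u) (⁅↑ʳ⁆ m v) ⟩
  ((xs ++ ys) ─ (∅ ++ ⁅ u ⁆)) ∪ (∅ ++ ⁅ v ⁆)     ≡⟨ cong (_∪ (∅ ++ ⁅ v ⁆)) (─-++ xs ∅ ys ⁅ u ⁆) ⟩
  ((xs ─ ∅) ++ (ys - u)) ∪ (∅ ++ ⁅ v ⁆)          ≡⟨ ∪-++ (xs ─ ∅) ∅ (ys - u) ⁅ v ⁆ ⟩
  ((xs ─ ∅) ∪ ∅) ++ exchange ys u v              ≡⟨ cong (_++ exchange ys u v) (trans (∪-identityʳ _) (p─⊥≡p xs)) ⟩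
  xs ++ exchange ys u v                          ∎
  where open ≡-Reasoning

data Side (n₁ n₂ : ℕ) : Fin (n₁ + n₂) → Set where
  left  : (i : Fin n₁) → Side n₁ n₂ (i ↑ˡ n₂)
  right : (j : Fin n₂) → Side n₁ n₂ (n₁ ↑ʳ j)

side : ∀ n₁ n₂ (k : Fin (n₁ + n₂)) → Side n₁ n₂ k
side n₁ n₂ k with splitAt n₁ k in eq
... | inj₁ i = subst (Side n₁ n₂) (splitAt⁻¹-↑ˡ eq) (left i)
... | inj₂ j = subst (Side n₁ n₂) (splitAt⁻¹-↑ʳ eq) (right j)

module DisjointUnion {n₁ n₂ : ℕ} (G₁ : Graph n₁) (G₂ : Graph n₂) where

  SumAdj : Fin n₁ ⊎ Fin n₂ → Fin n₁ ⊎ Fin n₂ → Set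
  SumAdj (inj₁ i) (inj₁ j) = Adj G₁ i j
  SumAdj (inj₂ i) (inj₂ j) = Adj G₂ i j
  SumAdj _        _        = ⊥

  SumAdj-sym : ∀ a b → SumAdj a b → SumAdj b a
  SumAdj-sym (inj₁ i) (inj₁ j) = adj-sym G₁
  SumAdj-sym (inj₂ i) (inj₂ j) = adj-sym G₂

  SumAdj-irrefl : ∀ a → ¬ SumAdj a a
  SumAdj-irrefl (inj₁ i) = adj-irrefl G₁
  SumAdj-irrefl (inj₂ j) = adj-irrefl G₂

  SumAdj? : ∀ a b → Dec (SumAdj a b)
  SumAdj? (inj₁ i) (inj₁ j) = adj? G₁ i j
  SumAdj? (inj₂ i) (inj₂ j) = adj? G₂ i j
  SumAdj? (inj₁ i) (inj₂ j) = no id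
  SumAdj? (inj₂ i) (inj₁ j) = no id

  G₁⊕G₂ : Graph (n₁ + n₂)
  G₁⊕G₂ = record
    { Adj        = λ u v → SumAdj (splitAt n₁ u) (splitAt n₁ v)
    ; adj-sym    = λ {u} {v} → SumAdj-sym (splitAt n₁ u) (splitAt n₁ v)
    ; adj-irrefl = λ {u} → SumAdj-irrefl (splitAt n₁ u)
    ; adj?       = λ u v → SumAdj? (splitAt n₁ u) (splitAt n₁ v)
    }

  adj-ll : ∀ i j → Adj G₁⊕G₂ (i ↑ˡ n₂) (j ↑ˡ n₂) ≡ Adj G₁ i j
  adj-ll i j = cong₂ SumAdj (splitAt-↑ˡ n₁ i n₂) (splitAt-↑ˡ n₁ j n₂)

  adj-rr : ∀ i j → Adj G₁⊕G₂ (n₁ ↑ʳ i) (n₁ ↑ʳ j) ≡ Adj G₂ i j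
  adj-rr i j = cong₂ SumAdj (splitAt-↑ʳ n₁ n₂ i) (splitAt-↑ʳ n₁ n₂ j)

  adj-lr : ∀ i j → Adj G₁⊕G₂ (i ↑ˡ n₂) (n₁ ↑ʳ j) ≡ ⊥
  adj-lr i j = cong₂ SumAdj (splitAt-↑ˡ n₁ i n₂) (splitAt-↑ʳ n₁ n₂ j)

  adj-rl : ∀ i j → Adj G₁⊕G₂ (n₁ ↑ʳ j) (i ↑ˡ n₂) ≡ ⊥
  adj-rl i j = cong₂ SumAdj (splitAt-↑ʳ n₁ n₂ j) (splitAt-↑ˡ n₁ i n₂)

  inl : ComponentEmbedding G₁ G₁⊕G₂
  inl = record
    { ι            = _↑ˡ n₂
    ; ι-injective  = ↑ˡ-injective n₂ _ _
    ; adj-preserve = λ {i} {j} → subst id (sym (adj-ll i j))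
    ; adj-reflect  = λ {i} {j} → subst id (adj-ll i j)
    ; closed       = λ {i} {w} → closed i w (side n₁ n₂ w)
    }
    where
    closed : ∀ i w → Side n₁ n₂ w → Adj G₁⊕G₂ (i ↑ˡ n₂) w → ∃[ j ] j ↑ˡ n₂ ≡ w
    closed i _ (left j)  _ = j , refl
    closed i _ (right j) a = ⊥-elim (subst id (adj-lr i j) a)

  inr : ComponentEmbedding G₂ G₁⊕G₂
  inr = record
    { ι            = n₁ ↑ʳ_
    ; ι-injective  = ↑ʳ-injective n₁ _ _
    ; adj-preserve = λ {i} {j} → subst id (sym (adj-rr i j))
    ; adj-reflect  = λ {i} {j} → subst id (adj-rr i j)
    ; closed       = λ {j} {w} → closed j w (side n₁ n₂ w)
    }
    where
    closed : ∀ j w → Side n₁ n₂ w → Adj G₁⊕G₂ (n₁ ↑ʳ j) w → ∃[ k ] n₁ ↑ʳ k ≡ w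
    closed j _ (right k) _ = k , refl
    closed j _ (left i)  a = ⊥-elim (subst id (adj-rl i j) a)

  open ComponentEmbedding using (adj-preserve; adj-reflect; closed)

  module L (xs : Subset n₁) (ys : Subset n₂) = ComponentEmbedding.Restriction inl xs (xs ++ ys) (lookup-++ˡ xs ys)
  module R (xs : Subset n₁) (ys : Subset n₂) = ComponentEmbedding.Restriction inr ys (xs ++ ys) (lookup-++ʳ xs ys)

  irredundant-split : ∀ {xs ys} → Irredundant G₁⊕G₂ (xs ++ ys) → Irredundant G₁ xs × Irredundant G₂ ys
  irredundant-split {xs} {ys} I =
    (λ v v∈xs → L.PN-reflect xs ys (proj₂ (I _ (L.∈-preserve xs ys v∈xs)))) ,
    (λ v v∈ys → R.PN-reflect xs ys (proj₂ (I _ (R.∈-preserve xs ys v∈ys))))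

  irredundant-join : ∀ {xs ys} → Irredundant G₁ xs → Irredundant G₂ ys → Irredundant G₁⊕G₂ (xs ++ ys)
  irredundant-join {xs} {ys} I₁ I₂ v = private-neighbour (side n₁ n₂ v)
    where
    private-neighbour : ∀ {v} → Side n₁ n₂ v → v ∈ xs ++ ys → ∃[ w ] InPN G₁⊕G₂ v (xs ++ ys) w
    private-neighbour (left i) i∈ with I₁ i (L.∈-reflect xs ys i∈)
    ... | w , pn = _ , L.PN-preserve xs ys pn
    private-neighbour (right j) j∈ with I₂ j (R.∈-reflect xs ys j∈)
    ... | w , pn = _ , R.PN-preserve xs ys pn

  IR-set-join : ∀ {xs ys} → IsIRSet G₁ xs → IsIRSet G₂ ys → IsIRSet G₁⊕G₂ (xs ++ ys)
  IR-set-join {xs} {ys} (I₁ , max₁) (I₂ , max₂) =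
    irredundant-join I₁ I₂ , λ D′ I′ → bounded I′ (Vec.splitAt n₁ D′)
    where
    bounded : ∀ {D′} → Irredundant G₁⊕G₂ D′ →
              (Σ (Subset n₁) λ as → Σ (Subset n₂) λ bs → D′ ≡ as ++ bs) → ∣ D′ ∣ ≤ ∣ xs ++ ys ∣
    bounded I′ (as , bs , refl) with irredundant-split I′
    ... | Ias , Ibs = subst₂ _≤_ (sym (∣++∣ as bs)) (sym (∣++∣ xs ys)) (+-mono-≤ (max₁ as Ias) (max₂ bs Ibs))

  -- Conversely, if xs were not maximum in G₁ then a larger irredundant as would
  -- make as ++ ys larger than xs ++ ys; similarly for ys.
  IR-set-split : ∀ {xs ys} → IsIRSet G₁⊕G₂ (xs ++ ys) → IsIRSet G₁ xs × IsIRSet G₂ ys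
  IR-set-split {xs} {ys} (I , max) with irredundant-split I
  ... | I₁ , I₂ =
    (I₁ , λ as Ias → +-cancelʳ-≤ (∣ ys ∣) (∣ as ∣) (∣ xs ∣)
                       (∣++∣-≤ as xs ys ys (max (as ++ ys) (irredundant-join Ias I₂)))) ,
    (I₂ , λ bs Ibs → +-cancelˡ-≤ (∣ xs ∣) (∣ bs ∣) (∣ ys ∣)
                       (∣++∣-≤ xs xs bs ys (max (xs ++ bs) (irredundant-join I₁ Ibs))))

  IRAdj-left : ∀ {xs xs′ ys} → IRAdj G₁ xs xs′ → IRAdj G₁⊕G₂ (xs ++ ys) (xs′ ++ ys)
  IRAdj-left {xs} {xs′} {ys} (u , v , u∈ , v∈ , a , eq) =
    u ↑ˡ n₂ , v ↑ˡ n₂ , L.∈-preserve xs ys u∈ , L.∈-preserve xs′ ys v∈ , adj-preserve inl a ,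
    trans (cong (_++ ys) eq) (sym (exchange-++ˡ xs ys u v))

  IRAdj-right : ∀ {xs ys ys′} → IRAdj G₂ ys ys′ → IRAdj G₁⊕G₂ (xs ++ ys) (xs ++ ys′)
  IRAdj-right {xs} {ys} {ys′} (u , v , u∈ , v∈ , a , eq) =
    n₁ ↑ʳ u , n₁ ↑ʳ v , R.∈-preserve xs ys u∈ , R.∈-preserve xs ys′ v∈ , adj-preserve inr a ,
    trans (cong (xs ++_) eq) (sym (exchange-++ʳ xs ys u v))

  IRAdj-split : ∀ {xs xs′ ys ys′} → IRAdj G₁⊕G₂ (xs ++ ys) (xs′ ++ ys′) →
                (xs ≡ xs′ × IRAdj G₂ ys ys′) ⊎ (IRAdj G₁ xs xs′ × ys ≡ ys′)
  IRAdj-split {xs} {xs′} {ys} {ys′} (u , v , u∈ , v∈ , a , eq) = by-side (side n₁ n₂ u) u∈ a eq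
    where
    by-side : ∀ {u} → Side n₁ n₂ u → u ∈ xs ++ ys → Adj G₁⊕G₂ u v → xs′ ++ ys′ ≡ exchange (xs ++ ys) u v →
              (xs ≡ xs′ × IRAdj G₂ ys ys′) ⊎ (IRAdj G₁ xs xs′ × ys ≡ ys′)
    by-side (left i) i∈ a eq with closed inl a
    ... | j , refl with ++-injective xs′ (exchange xs i j) (trans eq (exchange-++ˡ xs ys i j))
    ...   | e₁ , e₂ = inj₂ ((i , j , L.∈-reflect xs ys i∈ , L.∈-reflect xs′ ys′ v∈ , adj-reflect inl a , e₁) , sym e₂)
    by-side (right i) i∈ a eq with closed inr a
    ... | j , refl with ++-injective xs′ xs (trans eq (exchange-++ʳ xs ys i j))
    ...   | e₁ , e₂ = inj₁ (sym e₁ , i , j , R.∈-reflect xs ys i∈ , R.∈-reflect xs′ ys′ v∈ , adj-reflect inr a , e₂)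

remQuot-injective : ∀ {m} n {k l : Fin (m * n)} → remQuot {m} n k ≡ remQuot n l → k ≡ l
remQuot-injective {m} n {k} {l} e =
  trans (sym (combine-remQuot {m} n k)) (trans (cong (uncurry (combine {m})) e) (combine-remQuot {m} n l))

□-IR-graph : ∀ {m₁ m₂} {H₁ : Graph m₁} {H₂ : Graph m₂} → IsIRGraph H₁ → IsIRGraph H₂ → IsIRGraph (H₁ □ H₂)
□-IR-graph {m₁} {m₂} {H₁} {H₂} (n₁ , G₁ , I₁) (n₂ , G₂ , I₂) = n₁ + n₂ , G₁⊕G₂ , record
  { f      = F
  ; f-IR   = λ k → IR-set-join (I₁.f-IR _) (I₂.f-IR _)
  ; f-inj  = λ k l e → remQuot-injective {m₁} m₂ (coordinates-injective (++-injective (I₁.f _) (I₁.f _) e))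
  ; f-surj = λ D isIR → surjective isIR (Vec.splitAt n₁ D)
  ; f-adj  = adjacent
  ; f-adj⁻ = λ k l r → reflect (IRAdj-split r)
  }
  where
  open DisjointUnion G₁ G₂
  module I₁ = IRIso I₁
  module I₂ = IRIso I₂

  π₁ : Fin (m₁ * m₂) → Fin m₁
  π₁ k = proj₁ (remQuot {m₁} m₂ k)

  π₂ : Fin (m₁ * m₂) → Fin m₂
  π₂ k = proj₂ (remQuot {m₁} m₂ k)

  F : Fin (m₁ * m₂) → Subset (n₁ + n₂)
  F k = I₁.f (π₁ k) ++ I₂.f (π₂ k)

  coordinates-injective : ∀ {k l} → I₁.f (π₁ k) ≡ I₁.f (π₁ l) × I₂.f (π₂ k) ≡ I₂.f (π₂ l) →
                          remQuot {m₁} m₂ k ≡ remQuot {m₁} m₂ l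
  coordinates-injective (e₁ , e₂) = cong₂ _,_ (I₁.f-inj _ _ e₁) (I₂.f-inj _ _ e₂)

  surjective : ∀ {D} → IsIRSet G₁⊕G₂ D →
               (Σ (Subset n₁) λ xs → Σ (Subset n₂) λ ys → D ≡ xs ++ ys) → ∃[ k ] F k ≡ D
  surjective isIR (xs , ys , refl) with IR-set-split isIR
  ... | isIR₁ , isIR₂ with I₁.f-surj xs isIR₁ | I₂.f-surj ys isIR₂
  ... | i , refl | j , refl =
    combine i j , cong (λ p → I₁.f (proj₁ p) ++ I₂.f (proj₂ p)) (remQuot-combine i j)

  adjacent : ∀ k l → Adj (H₁ □ H₂) k l → IRAdj G₁⊕G₂ (F k) (F l)
  adjacent k l (inj₁ (e , a)) =
    subst (λ i → IRAdj G₁⊕G₂ (F k) (I₁.f i ++ I₂.f (π₂ l))) e (IRAdj-right (I₂.f-adj _ _ a))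
  adjacent k l (inj₂ (a , e)) =
    subst (λ j → IRAdj G₁⊕G₂ (F k) (I₁.f (π₁ l) ++ I₂.f j)) e (IRAdj-left (I₁.f-adj _ _ a))

  reflect : ∀ {k l} → (I₁.f (π₁ k) ≡ I₁.f (π₁ l) × IRAdj G₂ (I₂.f (π₂ k)) (I₂.f (π₂ l)))
                    ⊎ (IRAdj G₁ (I₁.f (π₁ k)) (I₁.f (π₁ l)) × I₂.f (π₂ k) ≡ I₂.f (π₂ l)) →
            Adj (H₁ □ H₂) k l
  reflect (inj₁ (e , r)) = inj₁ (I₁.f-inj _ _ e , I₂.f-adj⁻ _ _ r)
  reflect (inj₂ (r , e)) = inj₂ (I₁.f-adj⁻ _ _ r , I₂.f-inj _ _ e)

Complete : ∀ {n} → Graph n → Set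
Complete {n} G = (u v : Fin n) → u ≢ v → Adj G u v

-- Every singleton is irredundant: its element is its own private neighbour.
singleton-irredundant : ∀ {n} (G : Graph n) (x : Fin n) → Irredundant G ⁅ x ⁆
singleton-irredundant G x v v∈⁅x⁆ = v , inj₁ refl ,
  λ u u∈⁅x⁆ u≢v _ → u≢v (trans (x∈⁅y⁆⇒x≡y x u∈⁅x⁆) (sym (x∈⁅y⁆⇒x≡y x v∈⁅x⁆)))

p─p≡∅ : ∀ {n} (p : Subset n) → p ─ p ≡ ∅
p─p≡∅ []            = refl
p─p≡∅ (inside ∷ p)  = cong (outside ∷_) (p─p≡∅ p)
p─p≡∅ (outside ∷ p) = cong (outside ∷_) (p─p≡∅ p)

∣empty∣≡0 : ∀ {n} {D : Subset n} → Empty D → ∣ D ∣ ≡ 0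
∣empty∣≡0 {n} empty = trans (cong ∣_∣ (Empty-unique empty)) (∣⊥∣≡0 n)

exchange-⁅⁆ : ∀ {n} (x y : Fin n) → exchange ⁅ x ⁆ x y ≡ ⁅ y ⁆
exchange-⁅⁆ x y = trans (cong (_∪ ⁅ y ⁆) (p─p≡∅ ⁅ x ⁆)) (∪-identityˡ ⁅ y ⁆)

module CompleteGraph {k : ℕ} (G : Graph (suc k)) (complete : Complete G) where

  dominates : ∀ u w → InN[_] G u w
  dominates u w with w ≟ u
  ... | yes w≡u = inj₁ w≡u
  ... | no  w≢u = inj₂ (complete u w (w≢u ∘ sym))

  irredundant-⊆⁅⁆ : ∀ {D x} → Irredundant G D → x ∈ D → D ⊆ ⁅ x ⁆
  irredundant-⊆⁅⁆ {D} {x} I x∈D {y} y∈D with y ≟ x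
  ... | yes refl = x∈⁅x⁆ x
  ... | no  y≢x  = ⊥-elim (proj₂ (proj₂ (I y y∈D)) x x∈D (y≢x ∘ sym) (dominates x _))

  irredundant-size : ∀ {D} → Irredundant G D → ∣ D ∣ ≤ 1
  irredundant-size {D} I with nonempty? D
  ... | yes (x , x∈D) = subst (∣ D ∣ ≤_) (∣⁅x⁆∣≡1 x) (p⊆q⇒∣p∣≤∣q∣ (irredundant-⊆⁅⁆ I x∈D))
  ... | no  empty     = subst (_≤ 1) (sym (∣empty∣≡0 empty)) z≤n

  singleton-IR-set : ∀ x → IsIRSet G ⁅ x ⁆
  singleton-IR-set x = singleton-irredundant G x , λ D′ I′ → subst (∣ D′ ∣ ≤_) (sym (∣⁅x⁆∣≡1 x)) (irredundant-size I′)

  IR-set-singleton : ∀ {D} → IsIRSet G D → ∃[ x ] ⁅ x ⁆ ≡ D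
  IR-set-singleton {D} (I , max) with nonempty? D
  ... | yes (x , x∈D) = x , ⊆-antisym (λ y∈⁅x⁆ → subst (_∈ D) (sym (x∈⁅y⁆⇒x≡y x y∈⁅x⁆)) x∈D) (irredundant-⊆⁅⁆ I x∈D)
  ... | no  empty     = ⊥-elim (1≰0 (begin
    1               ≡⟨ sym (∣⁅x⁆∣≡1 x₀) ⟩
    ∣ ⁅ x₀ ⁆ ∣      ≤⟨ max ⁅ x₀ ⁆ (singleton-irredundant G x₀) ⟩
    ∣ D ∣           ≡⟨ ∣empty∣≡0 empty ⟩
    0               ∎))
    where
    open ≤-Reasoning
    x₀ : Fin (suc k)
    x₀ = zero
    1≰0 : ¬ 1 ≤ 0
    1≰0 ()

  self-IR-graph : IsIRGraph G
  self-IR-graph = suc k , G , record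
    { f      = ⁅_⁆
    ; f-IR   = singleton-IR-set
    ; f-inj  = λ i j e → x∈⁅y⁆⇒x≡y j (subst (i ∈_) e (x∈⁅x⁆ i))
    ; f-surj = λ D isIR → IR-set-singleton isIR
    ; f-adj  = λ i j a → i , j , x∈⁅x⁆ i , x∈⁅x⁆ j , a , sym (exchange-⁅⁆ i j)
    ; f-adj⁻ = λ { i j (u , v , u∈ , v∈ , a , _) →
                   subst₂ (Adj G) (x∈⁅y⁆⇒x≡y i u∈) (x∈⁅y⁆⇒x≡y j v∈) a }
    }

K₁-complete : Complete K₁
K₁-complete zero zero 0≢0 = ⊥-elim (0≢0 refl)

K₂-complete : Complete K₂
K₂-complete u v u≢v = u≢v

hypercube-IR-graph : ∀ n → IsIRGraph (Q n)
hypercube-IR-graph ℕ.zero    = CompleteGraph.self-IR-graph K₁ K₁-complete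
hypercube-IR-graph (suc n) = □-IR-graph (CompleteGraph.self-IR-graph K₂ K₂-complete) (hypercube-IR-graph n)

record GraphIso {m m′ : ℕ} (H : Graph m) (H′ : Graph m′) : Set where
  field
    to           : Fin m → Fin m′
    from         : Fin m′ → Fin m
    from-to      : ∀ i → from (to i) ≡ i
    to-from      : ∀ j → to (from j) ≡ j
    adj-preserve : ∀ i j → Adj H i j → Adj H′ (to i) (to j)
    adj-reflect  : ∀ i j → Adj H′ (to i) (to j) → Adj H i j

IR-graph-transport : ∀ {m m′} {H : Graph m} {H′ : Graph m′} → GraphIso H H′ → IsIRGraph H′ → IsIRGraph H
IR-graph-transport σ (n , G , I) = n , G , record
  { f      = I.f ∘ to
  ; f-IR   = I.f-IR ∘ to
  ; f-inj  = λ i j e → trans (sym (from-to i)) (trans (cong from (I.f-inj _ _ e)) (from-to j))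
  ; f-surj = λ D isIR → let (j , e) = I.f-surj D isIR in from j , trans (cong I.f (to-from j)) e
  ; f-adj  = λ i j a → I.f-adj _ _ (adj-preserve i j a)
  ; f-adj⁻ = λ i j r → adj-reflect i j (I.f-adj⁻ _ _ r)
  }
  where
  open GraphIso σ
  module I = IRIso I

by-exhaustion : ∀ {n} {P : Fin n → Fin n → Set} (P? : ∀ i j → Dec (P i j)) →
                {True (all? λ i → all? λ j → P? i j)} → ∀ i j → P i j
by-exhaustion P? {checked} = toWitness checked

-- The 4-cycle 0 - 1 - 2 - 3 - 0 is the square Q 2, whose cycle is 0 - 1 - 3 - 2 - 0.
C₄≅Q₂ : GraphIso C₄ (Q 2)
C₄≅Q₂ = record
  { to           = σ
  ; from         = σ
  ; from-to      = σ-involutive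
  ; to-from      = σ-involutive
  ; adj-preserve = by-exhaustion (λ i j → adj? C₄ i j →-dec adj? (Q 2) (σ i) (σ j))
  ; adj-reflect  = by-exhaustion (λ i j → adj? (Q 2) (σ i) (σ j) →-dec adj? C₄ i j)
  }
  where
  σ : Fin 4 → Fin 4
  σ zero                   = zero
  σ (suc zero)             = suc zero
  σ (suc (suc zero))       = suc (suc (suc zero))
  σ (suc (suc (suc zero))) = suc (suc zero)

  σ-involutive : ∀ i → σ (σ i) ≡ i
  σ-involutive zero                   = refl
  σ-involutive (suc zero)             = refl
  σ-involutive (suc (suc zero))       = refl
  σ-involutive (suc (suc (suc zero))) = refl

proposition2p1 : ((m₁ m₂ : ℕ) (H₁ : Graph m₁) (H₂ : Graph m₂) → IsIRGraph H₁ → IsIRGraph H₂ → IsIRGraph (H₁ □ H₂))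
    × ((n : ℕ) → 1 ≤ n → IsIRGraph (Q n))
    × IsIRGraph C₄
proposition2p1 =
  (λ m₁ m₂ H₁ H₂ → □-IR-graph) ,
  (λ n _ → hypercube-IR-graph n) ,
  IR-graph-transport C₄≅Q₂ (hypercube-IR-graph 2)
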